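{- Let $p(z)\in\mathbb{Z}[z]$ be a non-odd polynomial of degree $d\ge2$ with positive leading coefficient, and suppose $0<1/k\ll1/q\ll1/\|p\|,1/d\le1/2$. Let $t\in[d-1]$. Then for every nonzero integer vector $(c_1,\dots,c_t)$ with each $c_i\in[-\frac kq,\frac kq]$, we have $\left|\sum_{i=1}^t c_i\,m_i(k)\right|>\frac12k^{d-t}$.
   Context: $\|p\|=d+\sum_i|a_i|$ for $p(z)=a_dz^d+\dots+a_0$; a polynomial is odd if it takes only odd values on $\mathbb{Z}$, non-odd otherwise. $m_s(k)=p(k+s)-p(k)$. The hierarchy means $q$ is sufficiently large in terms of $\|p\|,d$ and $k$ sufficiently large in terms of $q$. -}

module Defs where

open import Data.Nat as ℕ using (ℕ; zero; suc)
open import Data.Fin using (Fin; toℕ)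
import Data.Fin as Fin
open import Data.Integer as ℤ using (ℤ; +_)
open import Data.Integer.Divisibility using (_∣_)
open import Data.Product using (∃)

Σℤ : (n : ℕ) → (Fin n → ℤ) → ℤ
Σℤ zero    f = + 0
Σℤ (suc n) f = f Fin.zero ℤ.+ Σℤ n (λ i → f (Fin.suc i))

Σℕ : (n : ℕ) → (Fin n → ℕ) → ℕ
Σℕ zero    f = 0
Σℕ (suc n) f = f Fin.zero ℕ.+ Σℕ n (λ i → f (Fin.suc i))

-- A polynomial of formal degree d: coefficients a i (i = 0..d), a d the leading one.
Coeffs : ℕ → Set
Coeffs d = Fin (suc d) → ℤ

lead : (d : ℕ) → Coeffs d → ℤ
lead d a = a (Fin.fromℕ d)

eval : (d : ℕ) → Coeffs d → ℤ → ℤ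
eval d a x = Σℤ (suc d) (λ i → a i ℤ.* (x ℤ.^ toℕ i))

norm : (d : ℕ) → Coeffs d → ℕ
norm d a = d ℕ.+ Σℕ (suc d) (λ i → ℤ.∣ a i ∣)

-- p is odd iff p(n) is odd for every integer n; non-odd iff some value is even.
NonOdd : (d : ℕ) → Coeffs d → Set
NonOdd d a = ∃ λ (n : ℤ) → (+ 2) ∣ eval d a n

m : (d : ℕ) → Coeffs d → (s : ℕ) → (k : ℕ) → ℤ
m d a s k = eval d a (+ (k ℕ.+ s)) ℤ.- eval d a (+ k)

-- Write s_i = i + 1 and b_r = Σ_i c_i s_i^r. Expanding (k + s)^n binomially,
--   Σ_i c_i m_{s_i}(k) = Σ_n a_n Σ_{1 ≤ r ≤ n} C(n,r) k^(n−r) b_r.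
-- As c ≠ 0 and the nodes s_i are distinct and nonzero, the Vandermonde relations force b_r ≠ 0
-- for some r ≤ t; let j be the least such r. The term a_d C(d,j) k^(d−j) b_j has absolute value
-- at least k^(d−j) ≥ k^(d−t). Every other nonzero term carries a smaller power of k, and
-- |c_i| ≤ k/q gives q|b_r| ≤ t^(r+1) k, so q times the remainder is O_‖p‖(k^(d−j)); once q is
-- four times that constant, the main term wins by a factor 3/4.

module Submission where

open import Defs
open import Data.Nat as ℕ using (ℕ; zero; suc; _≤_; _<_; _∸_; _^_; z≤n; s≤s)
import Data.Nat.Properties as ℕP
import Data.Nat.Tactic.RingSolver as ℕ-Ring
open import Data.Nat.Combinatorics using (_C_; nCk+nC[k+1]≡[n+1]C[k+1])
open import Data.Fin as Fin using (Fin; toℕ)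
import Data.Fin.Properties as FinP
open import Data.Integer as ℤ using (ℤ; +_; 0ℤ; _+_; _-_; _*_)
import Data.Integer.Properties as ℤP
open import Data.Integer.Tactic.RingSolver using (solve-∀)
open import Data.Product using (∃; _×_; _,_)
open import Data.Sum as Sum using (_⊎_; inj₁; inj₂; [_,_]′)
open import Data.Vec.Functional using (Vector; removeAt)
open import Function using (_∘_; id; flip)
open import Function.Definitions using (Injective)
open import Relation.Binary.PropositionalEquality
open import Relation.Nullary using (¬_; contradiction; yes; no)
open import Algebra.Properties.Semiring.Sum ℤP.+-*-semiring
  using (sum; sum-syntax; sum-cong-≗; sum-replicate-zero; sum-remove; ∑-comm; *-distribˡ-sum)
import Algebra.Properties.CommutativeSemiring.Binomial ℤP.+-*-commutativeSemiring as Binomial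
import Algebra.Properties.Semiring.Exp ℤP.+-*-semiring as SemiringExp
import Algebra.Properties.Semiring.Mult ℤP.+-*-semiring as SemiringMult

x*y-x*z≡x*[y-z] : ∀ x y z → x * y - x * z ≡ x * (y - z)
x*y-x*z≡x*[y-z] = solve-∀

i*j≡0⇒i≡0 : ∀ i {j} → j ≢ 0ℤ → i * j ≡ 0ℤ → i ≡ 0ℤ
i*j≡0⇒i≡0 i j≢0 ij≡0 = [ id , flip contradiction j≢0 ]′ (ℤP.i*j≡0⇒i≡0∨j≡0 i ij≡0)

∣i∣≢0 : ∀ {i} → i ≢ 0ℤ → ℕ.NonZero ℤ.∣ i ∣
∣i∣≢0 i≢0 = ℕ.≢-nonZero (i≢0 ∘ ℤP.∣i∣≡0⇒i≡0)

∣i^n∣≡∣i∣^n : ∀ i n → ℤ.∣ i ℤ.^ n ∣ ≡ ℤ.∣ i ∣ ^ n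
∣i^n∣≡∣i∣^n i zero    = refl
∣i^n∣≡∣i∣^n i (suc n) = trans (ℤP.abs-* i (i ℤ.^ n)) (cong (ℤ.∣ i ∣ ℕ.*_) (∣i^n∣≡∣i∣^n i n))

q*∣i*j∣≡∣i∣*[q*∣j∣] : ∀ q i j → q ℕ.* ℤ.∣ i * j ∣ ≡ ℤ.∣ i ∣ ℕ.* (q ℕ.* ℤ.∣ j ∣)
q*∣i*j∣≡∣i∣*[q*∣j∣] q i j = trans (cong (q ℕ.*_) (ℤP.abs-* i j)) (x*[y*z]≡y*[x*z] q ℤ.∣ i ∣ ℤ.∣ j ∣)
  where
  x*[y*z]≡y*[x*z] : ∀ x y z → x ℕ.* (y ℕ.* z) ≡ y ℕ.* (x ℕ.* z)
  x*[y*z]≡y*[x*z] = ℕ-Ring.solve-∀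

Σℤ≡sum : ∀ n (f : Vector ℤ n) → Σℤ n f ≡ sum f
Σℤ≡sum zero    f = refl
Σℤ≡sum (suc n) f = cong (λ s → f Fin.zero + s) (Σℤ≡sum n (f ∘ Fin.suc))

f≤Σℕ : ∀ n (f : Fin n → ℕ) i → f i ≤ Σℕ n f
f≤Σℕ (suc n) f Fin.zero    = ℕP.m≤m+n (f Fin.zero) _
f≤Σℕ (suc n) f (Fin.suc i) = ℕP.≤-trans (f≤Σℕ n (f ∘ Fin.suc) i) (ℕP.m≤n+m _ (f Fin.zero))

∑-distrib-- : ∀ {n} (f g : Vector ℤ n) → ∑[ i < n ] (f i - g i) ≡ sum f - sum g
∑-distrib-- {zero}  f g = refl
∑-distrib-- {suc n} f g = begin
  (f₀ - g₀) + ∑[ i < n ] (f (Fin.suc i) - g (Fin.suc i))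
    ≡⟨ cong (λ s → (f₀ - g₀) + s) (∑-distrib-- (f ∘ Fin.suc) (g ∘ Fin.suc)) ⟩
  (f₀ - g₀) + (∑f - ∑g)
    ≡⟨ [a-b]+[c-d]≡[a+c]-[b+d] f₀ g₀ ∑f ∑g ⟩
  (f₀ + ∑f) - (g₀ + ∑g) ∎
  where
  open ≡-Reasoning
  f₀ = f Fin.zero
  g₀ = g Fin.zero
  ∑f = sum (f ∘ Fin.suc)
  ∑g = sum (g ∘ Fin.suc)
  [a-b]+[c-d]≡[a+c]-[b+d] : ∀ a b c d → (a - b) + (c - d) ≡ (a + c) - (b + d)
  [a-b]+[c-d]≡[a+c]-[b+d] = solve-∀

∑≡0 : ∀ {n} (f : Vector ℤ n) → (∀ i → f i ≡ 0ℤ) → sum f ≡ 0ℤ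
∑≡0 {n} f f≡0 = trans (sum-cong-≗ f≡0) (sum-replicate-zero n)

∑-∑-comm-* : ∀ {m n} (u : Vector ℤ m) (v : Vector ℤ n) (w : Fin m → Fin n → ℤ) →
  ∑[ i < m ] (u i * ∑[ j < n ] (v j * w i j)) ≡ ∑[ j < n ] (v j * ∑[ i < m ] (u i * w i j))
∑-∑-comm-* {m} {n} u v w = begin
  ∑[ i < m ] (u i * ∑[ j < n ] (v j * w i j))
    ≡⟨ sum-cong-≗ (λ i → *-distribˡ-sum (u i) (λ j → v j * w i j)) ⟩
  ∑[ i < m ] ∑[ j < n ] (u i * (v j * w i j))
    ≡⟨ ∑-comm (λ i j → u i * (v j * w i j)) ⟩
  ∑[ j < n ] ∑[ i < m ] (u i * (v j * w i j))
    ≡⟨ sum-cong-≗ (λ j → sum-cong-≗ (λ i → x*[y*z]≡y*[x*z] (u i) (v j) (w i j))) ⟩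
  ∑[ j < n ] ∑[ i < m ] (v j * (u i * w i j))
    ≡⟨ sum-cong-≗ (λ j → *-distribˡ-sum (v j) (λ i → u i * w i j)) ⟨
  ∑[ j < n ] (v j * ∑[ i < m ] (u i * w i j)) ∎
  where
  open ≡-Reasoning
  x*[y*z]≡y*[x*z] : ∀ x y z → x * (y * z) ≡ y * (x * z)
  x*[y*z]≡y*[x*z] = solve-∀

q*∣∑∣≤n*W : ∀ q W {n} (f : Vector ℤ n) → (∀ i → q ℕ.* ℤ.∣ f i ∣ ≤ W) →
  q ℕ.* ℤ.∣ sum f ∣ ≤ n ℕ.* W
q*∣∑∣≤n*W q W {zero}  f bound = ℕP.≤-reflexive (ℕP.*-zeroʳ q)
q*∣∑∣≤n*W q W {suc n} f bound = begin
  q ℕ.* ℤ.∣ f Fin.zero + sum (f ∘ Fin.suc) ∣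
    ≤⟨ ℕP.*-monoʳ-≤ q (ℤP.∣i+j∣≤∣i∣+∣j∣ (f Fin.zero) _) ⟩
  q ℕ.* (ℤ.∣ f Fin.zero ∣ ℕ.+ ℤ.∣ sum (f ∘ Fin.suc) ∣)
    ≡⟨ ℕP.*-distribˡ-+ q _ _ ⟩
  q ℕ.* ℤ.∣ f Fin.zero ∣ ℕ.+ q ℕ.* ℤ.∣ sum (f ∘ Fin.suc) ∣
    ≤⟨ ℕP.+-mono-≤ (bound Fin.zero) (q*∣∑∣≤n*W q W (f ∘ Fin.suc) (bound ∘ Fin.suc)) ⟩
  W ℕ.+ n ℕ.* W ∎
  where open ℕP.≤-Reasoning

q*∣∑-fᵢ∣≤n*W : ∀ q W {n} (f : Vector ℤ n) i₀ → (∀ i → i ≢ i₀ → q ℕ.* ℤ.∣ f i ∣ ≤ W) →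
  q ℕ.* ℤ.∣ sum f - f i₀ ∣ ≤ n ℕ.* W
q*∣∑-fᵢ∣≤n*W q W {suc n} f i₀ bound = begin
  q ℕ.* ℤ.∣ sum f - f i₀ ∣
    ≡⟨ cong (λ s → q ℕ.* ℤ.∣ s - f i₀ ∣) (sum-remove {i = i₀} f) ⟩
  q ℕ.* ℤ.∣ f i₀ + sum (removeAt f i₀) - f i₀ ∣
    ≡⟨ cong (λ s → q ℕ.* ℤ.∣ s ∣) ([x+y]-x≡y (f i₀) _) ⟩
  q ℕ.* ℤ.∣ sum (removeAt f i₀) ∣
    ≤⟨ q*∣∑∣≤n*W q W (removeAt f i₀) (λ i → bound _ (FinP.punchInᵢ≢i i₀ i)) ⟩
  n ℕ.* W
    ≤⟨ ℕP.m≤n+m (n ℕ.* W) W ⟩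
  suc n ℕ.* W ∎
  where
  open ℕP.≤-Reasoning
  [x+y]-x≡y : ∀ x y → x + y - x ≡ y
  [x+y]-x≡y = solve-∀

^≡^ : ∀ x n → x SemiringExp.^ n ≡ x ℤ.^ n
^≡^ x zero    = refl
^≡^ x (suc n) = cong (x *_) (^≡^ x n)

×≡* : ∀ n x → n SemiringMult.× x ≡ + n * x
×≡* zero    x = sym (ℤP.*-zeroˡ x)
×≡* (suc n) x = begin
  x + n SemiringMult.× x ≡⟨ cong (λ s → x + s) (×≡* n x) ⟩
  x + + n * x            ≡⟨ y+z*y≡[1+z]*y x (+ n) ⟩
  (+ 1 + + n) * x        ∎
  where
  open ≡-Reasoning
  y+z*y≡[1+z]*y : ∀ y z → y + z * y ≡ (+ 1 + z) * y
  y+z*y≡[1+z]*y = solve-∀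

[x+y]^n-y^n≡∑ : ∀ n x y →
  (x + y) ℤ.^ n - y ℤ.^ n ≡ ∑[ r < n ] (+ (n C suc (toℕ r)) * y ℤ.^ (n ∸ suc (toℕ r)) * x ℤ.^ suc (toℕ r))
[x+y]^n-y^n≡∑ n x y = begin
  (x + y) ℤ.^ n - y ℤ.^ n
    ≡⟨ cong (_- y ℤ.^ n) (trans (sym (^≡^ (x + y) n)) (Binomial.theorem n x y)) ⟩
  (term Fin.zero + ∑[ r < n ] term (Fin.suc r)) - y ℤ.^ n
    ≡⟨ cong (λ h → (h + ∑[ r < n ] term (Fin.suc r)) - y ℤ.^ n) head-term ⟩
  (y ℤ.^ n + ∑[ r < n ] term (Fin.suc r)) - y ℤ.^ n
    ≡⟨ [u+v]-u≡v (y ℤ.^ n) _ ⟩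
  ∑[ r < n ] term (Fin.suc r)
    ≡⟨ sum-cong-≗ tail-term ⟩
  ∑[ r < n ] (+ (n C suc (toℕ r)) * y ℤ.^ (n ∸ suc (toℕ r)) * x ℤ.^ suc (toℕ r)) ∎
  where
  open ≡-Reasoning
  term = Binomial.binomialTerm x y n
  [u+v]-u≡v : ∀ u v → (u + v) - u ≡ v
  [u+v]-u≡v = solve-∀
  u*[v*w]≡u*w*v : ∀ u v w → u * (v * w) ≡ u * w * v
  u*[v*w]≡u*w*v = solve-∀
  head-term : term Fin.zero ≡ y ℤ.^ n
  head-term = trans (ℤP.+-identityʳ _) (trans (ℤP.*-identityˡ _) (^≡^ y n))
  tail-term : ∀ r → term (Fin.suc r) ≡ + (n C suc (toℕ r)) * y ℤ.^ (n ∸ suc (toℕ r)) * x ℤ.^ suc (toℕ r)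
  tail-term r = begin
    term (Fin.suc r)
      ≡⟨ ×≡* (n C ρ) _ ⟩
    + (n C ρ) * (x SemiringExp.^ ρ * y SemiringExp.^ (n ∸ ρ))
      ≡⟨ cong₂ (λ u v → + (n C ρ) * (u * v)) (^≡^ x ρ) (^≡^ y (n ∸ ρ)) ⟩
    + (n C ρ) * (x ℤ.^ ρ * y ℤ.^ (n ∸ ρ))
      ≡⟨ u*[v*w]≡u*w*v (+ (n C ρ)) (x ℤ.^ ρ) (y ℤ.^ (n ∸ ρ)) ⟩
    + (n C ρ) * y ℤ.^ (n ∸ ρ) * x ℤ.^ ρ ∎
    where ρ = suc (toℕ r)

nCk≤2^n : ∀ n k → n C k ≤ 2 ^ n
nCk≤2^n zero    zero    = ℕP.≤-refl
nCk≤2^n zero    (suc k) = z≤n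
nCk≤2^n (suc n) zero    = ℕP.m^n>0 2 (suc n)
nCk≤2^n (suc n) (suc k) = begin
  suc n C suc k         ≡⟨ nCk+nC[k+1]≡[n+1]C[k+1] n k ⟨
  n C k ℕ.+ n C suc k   ≤⟨ ℕP.+-mono-≤ (nCk≤2^n n k) (nCk≤2^n n (suc k)) ⟩
  2 ^ n ℕ.+ 2 ^ n       ≡⟨ cong (2 ^ n ℕ.+_) (ℕP.+-identityʳ (2 ^ n)) ⟨
  2 ^ suc n             ∎
  where open ℕP.≤-Reasoning

k≤n⇒nCk>0 : ∀ {n k} → k ≤ n → 0 < n C k
k≤n⇒nCk>0 {n}     {zero}  _         = ℕP.≤-refl
k≤n⇒nCk>0 {suc n} {suc k} (s≤s k≤n) =
  subst (0 <_) (nCk+nC[k+1]≡[n+1]C[k+1] n k) (ℕP.≤-trans (k≤n⇒nCk>0 k≤n) (ℕP.m≤m+n _ _))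

∑c*x^r≡0⇒c≡0 : ∀ {t} (x c : Vector ℤ t) → (∀ i → x i ≢ 0ℤ) → Injective _≡_ _≡_ x →
  (∀ (r : Fin t) → ∑[ i < t ] (c i * x i ℤ.^ suc (toℕ r)) ≡ 0ℤ) → ∀ i → c i ≡ 0ℤ
∑c*x^r≡0⇒c≡0 {zero}  _ _ _   _     _      ()
∑c*x^r≡0⇒c≡0 {suc t} x c x≢0 x-inj vanish = λ { Fin.zero → c₀≡0 ; (Fin.suc i) → c[1+i]≡0 i }
  where
  open ≡-Reasoning
  x₀ = x Fin.zero

  -- The relations for c′ are those for c at exponent r + 2 minus x₀ times those at r + 1;
  -- the i = 0 summand drops out, leaving a system of one size smaller.
  c′ : Vector ℤ t
  c′ i = c (Fin.suc i) * (x (Fin.suc i) - x₀)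

  vanish′ : ∀ (r : Fin t) → ∑[ i < t ] (c′ i * x (Fin.suc i) ℤ.^ suc (toℕ r)) ≡ 0ℤ
  vanish′ r = begin
    ∑[ i < t ] (c′ i * x (Fin.suc i) ℤ.^ ρ)
      ≡⟨ trans (cong (_+ ∑[ i < t ] (c′ i * x (Fin.suc i) ℤ.^ ρ)) head≡0) (ℤP.+-identityˡ _) ⟨
    ∑[ i < suc t ] (c i * (x i - x₀) * x i ℤ.^ ρ)
      ≡⟨ sum-cong-≗ (λ i → u*[v-w]*z≡u*[v*z]-w*[u*z] (c i) (x i) x₀ (x i ℤ.^ ρ)) ⟩
    ∑[ i < suc t ] (c i * x i ℤ.^ suc ρ - x₀ * (c i * x i ℤ.^ ρ))
      ≡⟨ ∑-distrib-- (λ i → c i * x i ℤ.^ suc ρ) (λ i → x₀ * (c i * x i ℤ.^ ρ)) ⟩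
    relation (suc ρ) - ∑[ i < suc t ] (x₀ * (c i * x i ℤ.^ ρ))
      ≡⟨ cong (relation (suc ρ) -_) (*-distribˡ-sum x₀ (λ i → c i * x i ℤ.^ ρ)) ⟨
    relation (suc ρ) - x₀ * relation ρ
      ≡⟨ cong₂ (λ u v → u - x₀ * v) (vanish (Fin.suc r))
           (subst (λ e → relation (suc e) ≡ 0ℤ) (FinP.toℕ-inject₁ r) (vanish (Fin.inject₁ r))) ⟩
    0ℤ - x₀ * 0ℤ
      ≡⟨ cong (0ℤ -_) (ℤP.*-zeroʳ x₀) ⟩
    0ℤ ∎
    where
    ρ = suc (toℕ r)
    relation : ℕ → ℤ
    relation e = ∑[ i < suc t ] (c i * x i ℤ.^ e)
    u*[v-v]*w≡0 : ∀ u v w → u * (v - v) * w ≡ 0ℤ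
    u*[v-v]*w≡0 = solve-∀
    u*[v-w]*z≡u*[v*z]-w*[u*z] : ∀ u v w z → u * (v - w) * z ≡ u * (v * z) - w * (u * z)
    u*[v-w]*z≡u*[v*z]-w*[u*z] = solve-∀
    head≡0 : c Fin.zero * (x₀ - x₀) * x₀ ℤ.^ ρ ≡ 0ℤ
    head≡0 = u*[v-v]*w≡0 (c Fin.zero) x₀ (x₀ ℤ.^ ρ)

  c[1+i]≡0 : ∀ i → c (Fin.suc i) ≡ 0ℤ
  c[1+i]≡0 i = i*j≡0⇒i≡0 (c (Fin.suc i)) x[1+i]-x₀≢0
    (∑c*x^r≡0⇒c≡0 (x ∘ Fin.suc) c′ (x≢0 ∘ Fin.suc) (FinP.suc-injective ∘ x-inj) vanish′ i)
    where
    x[1+i]-x₀≢0 : x (Fin.suc i) - x₀ ≢ 0ℤ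
    x[1+i]-x₀≢0 eq = FinP.0≢1+n (sym (x-inj (ℤP.i-j≡0⇒i≡j _ _ eq)))

  c₀≡0 : c Fin.zero ≡ 0ℤ
  c₀≡0 = i*j≡0⇒i≡0 (c Fin.zero) (x≢0 Fin.zero ∘ ℤP.i^n≡0⇒i≡0 x₀ 1) (begin
    c Fin.zero * x₀ ℤ.^ 1
      ≡⟨ ℤP.+-identityʳ _ ⟨
    c Fin.zero * x₀ ℤ.^ 1 + 0ℤ
      ≡⟨ cong (λ s → c Fin.zero * x₀ ℤ.^ 1 + s) (∑≡0 (λ i → c (Fin.suc i) * x (Fin.suc i) ℤ.^ 1) tail≡0) ⟨
    c Fin.zero * x₀ ℤ.^ 1 + ∑[ i < t ] (c (Fin.suc i) * x (Fin.suc i) ℤ.^ 1)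
      ≡⟨ vanish Fin.zero ⟩
    0ℤ ∎)
    where
    tail≡0 : ∀ i → c (Fin.suc i) * x (Fin.suc i) ℤ.^ 1 ≡ 0ℤ
    tail≡0 i = trans (cong (_* x (Fin.suc i) ℤ.^ 1) (c[1+i]≡0 i)) (ℤP.*-zeroˡ (x (Fin.suc i) ℤ.^ 1))

moment : ∀ {t} → Vector ℤ t → ℕ → ℤ
moment {t} c r = ∑[ i < t ] (c i * (+ suc (toℕ i)) ℤ.^ r)

lowest-nonvanishing-moment : ∀ {t} (c : Vector ℤ t) i → c i ≢ 0ℤ →
  ∃ λ (j : Fin t) → moment c (suc (toℕ j)) ≢ 0ℤ × (∀ r → r < toℕ j → moment c (suc r) ≡ 0ℤ)
lowest-nonvanishing-moment {t} c i cᵢ≢0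
  with FinP.¬∀⟶∃¬-smallest t (λ j → moment c (suc (toℕ j)) ≡ 0ℤ) (λ j → moment c (suc (toℕ j)) ℤ.≟ 0ℤ) not-all
  where
  not-all : ¬ (∀ j → moment c (suc (toℕ j)) ≡ 0ℤ)
  not-all all≡0 = cᵢ≢0 (∑c*x^r≡0⇒c≡0 (λ i → + suc (toℕ i)) c (λ i ())
    (FinP.toℕ-injective ∘ ℕP.suc-injective ∘ ℤP.+-injective) all≡0 i)
... | j , moment≢0 , below≡0 = j , moment≢0 , λ r r<j →
  subst (λ x → moment c (suc x) ≡ 0ℤ) (trans (FinP.toℕ-inject (Fin.fromℕ< r<j)) (FinP.toℕ-fromℕ< r<j))
    (below≡0 (Fin.fromℕ< r<j))

module Expansion (k : ℕ) {t : ℕ} (c : Vector ℤ t) where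

  weight : ℕ → ℕ → ℤ
  weight n r = + (n C suc r) * (+ k) ℤ.^ (n ∸ suc r)

  term : ℕ → ℕ → ℤ
  term n r = weight n r * moment c (suc r)

  termSum : ℕ → ℤ
  termSum n = ∑[ r < n ] term n (toℕ r)

  m-expansion : ∀ d a s →
    m d a s k ≡ ∑[ n < suc d ] (a n * ∑[ r < toℕ n ] (weight (toℕ n) (toℕ r) * (+ s) ℤ.^ suc (toℕ r)))
  m-expansion d a s = begin
    eval d a (+ (k ℕ.+ s)) - eval d a (+ k)
      ≡⟨ cong₂ _-_ (Σℤ≡sum (suc d) (λ n → a n * (+ (k ℕ.+ s)) ℤ.^ toℕ n))
                   (Σℤ≡sum (suc d) (λ n → a n * (+ k) ℤ.^ toℕ n)) ⟩
    ∑[ n < suc d ] (a n * (+ (k ℕ.+ s)) ℤ.^ toℕ n) - ∑[ n < suc d ] (a n * (+ k) ℤ.^ toℕ n)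
      ≡⟨ ∑-distrib-- (λ n → a n * (+ (k ℕ.+ s)) ℤ.^ toℕ n) (λ n → a n * (+ k) ℤ.^ toℕ n) ⟨
    ∑[ n < suc d ] (a n * (+ (k ℕ.+ s)) ℤ.^ toℕ n - a n * (+ k) ℤ.^ toℕ n)
      ≡⟨ sum-cong-≗ (λ n → trans (x*y-x*z≡x*[y-z] (a n) ((+ (k ℕ.+ s)) ℤ.^ toℕ n) ((+ k) ℤ.^ toℕ n))
                                 (cong (a n *_) (difference (toℕ n)))) ⟩
    ∑[ n < suc d ] (a n * ∑[ r < toℕ n ] (weight (toℕ n) (toℕ r) * (+ s) ℤ.^ suc (toℕ r))) ∎
    where
    open ≡-Reasoning
    difference : ∀ n → (+ (k ℕ.+ s)) ℤ.^ n - (+ k) ℤ.^ n ≡ ∑[ r < n ] (weight n (toℕ r) * (+ s) ℤ.^ suc (toℕ r))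
    difference n = trans (cong (λ z → z ℤ.^ n - (+ k) ℤ.^ n) (trans (ℤP.pos-+ k s) (ℤP.+-comm (+ k) (+ s))))
                         ([x+y]^n-y^n≡∑ n (+ s) (+ k))

  ∑c*m≡∑a*termSum : ∀ d a → Σℤ t (λ i → c i * m d a (suc (toℕ i)) k) ≡ ∑[ n < suc d ] (a n * termSum (toℕ n))
  ∑c*m≡∑a*termSum d a = begin
    Σℤ t (λ i → c i * m d a (suc (toℕ i)) k)
      ≡⟨ Σℤ≡sum t _ ⟩
    ∑[ i < t ] (c i * m d a (suc (toℕ i)) k)
      ≡⟨ sum-cong-≗ (λ i → cong (c i *_) (m-expansion d a (suc (toℕ i)))) ⟩
    ∑[ i < t ] (c i * ∑[ n < suc d ] (a n * binomialPart n i))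
      ≡⟨ ∑-∑-comm-* c a (λ i n → binomialPart n i) ⟩
    ∑[ n < suc d ] (a n * ∑[ i < t ] (c i * binomialPart n i))
      ≡⟨ sum-cong-≗ (λ n → cong (a n *_)
           (∑-∑-comm-* {n = toℕ n} c (weight (toℕ n) ∘ toℕ) (λ i r → (+ suc (toℕ i)) ℤ.^ suc (toℕ r)))) ⟩
    ∑[ n < suc d ] (a n * termSum (toℕ n)) ∎
    where
    open ≡-Reasoning
    binomialPart : Fin (suc d) → Fin t → ℤ
    binomialPart n i = ∑[ r < toℕ n ] (weight (toℕ n) (toℕ r) * (+ suc (toℕ i)) ℤ.^ suc (toℕ r))

n∸[1+r]<d∸[1+j] : ∀ {j r n d} → j ≤ r → r < n → n ≤ d → n < d ⊎ j < r → n ∸ suc r < d ∸ suc j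
n∸[1+r]<d∸[1+j] {j} {r} {n} {d} j≤r r<n n≤d (inj₁ n<d) =
  ℕP.≤-<-trans (ℕP.∸-monoʳ-≤ n (s≤s j≤r)) (ℕP.∸-monoˡ-< n<d (ℕP.≤-trans (s≤s j≤r) r<n))
n∸[1+r]<d∸[1+j] {j} {r} {n} {d} j≤r r<n n≤d (inj₂ j<r) =
  ℕP.<-≤-trans (ℕP.∸-monoʳ-< (s≤s j<r) r<n) (ℕP.∸-monoˡ-≤ (suc j) n≤d)

-- |S| ≥ |M| − |S − M| ≥ P − P/4.
main-term-dominates : ∀ {q K P} (S M : ℤ) .{{_ : ℕ.NonZero K}} → 0 < P → 4 ℕ.* K ≤ q →
  P ≤ ℤ.∣ M ∣ → q ℕ.* ℤ.∣ S - M ∣ ≤ K ℕ.* P → P < 2 ℕ.* ℤ.∣ S ∣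
main-term-dominates {q} {K} {P} S M P>0 4K≤q P≤∣M∣ q*E≤K*P =
  ℕP.*-cancelˡ-< 2 P (2 ℕ.* ℤ.∣ S ∣) (begin-strict
    2 ℕ.* P                  <⟨ ℕP.m<m+n (2 ℕ.* P) P>0 ⟩
    2 ℕ.* P ℕ.+ P            ≤⟨ ℕP.+-cancelʳ-≤ P _ _ 3P+P≤4∣S∣+P ⟩
    2 ℕ.* (2 ℕ.* ℤ.∣ S ∣)    ∎)
  where
  open ℕP.≤-Reasoning
  E = ℤ.∣ S - M ∣
  x-[x-y]≡y : ∀ x y → x - (x - y) ≡ y
  x-[x-y]≡y = solve-∀
  x*[4*y]≡4*x*y : ∀ x y → x ℕ.* (4 ℕ.* y) ≡ 4 ℕ.* x ℕ.* y
  x*[4*y]≡4*x*y = ℕ-Ring.solve-∀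
  2*x+x+x≡4*x : ∀ x → 2 ℕ.* x ℕ.+ x ℕ.+ x ≡ 4 ℕ.* x
  2*x+x+x≡4*x = ℕ-Ring.solve-∀
  4*x+y≡2*[2*x]+y : ∀ x y → 4 ℕ.* x ℕ.+ y ≡ 2 ℕ.* (2 ℕ.* x) ℕ.+ y
  4*x+y≡2*[2*x]+y = ℕ-Ring.solve-∀
  4E≤P : 4 ℕ.* E ≤ P
  4E≤P = ℕP.*-cancelˡ-≤ K (begin
    K ℕ.* (4 ℕ.* E)  ≡⟨ x*[4*y]≡4*x*y K E ⟩
    4 ℕ.* K ℕ.* E    ≤⟨ ℕP.*-monoˡ-≤ E 4K≤q ⟩
    q ℕ.* E          ≤⟨ q*E≤K*P ⟩
    K ℕ.* P          ∎)
  P≤∣S∣+E : P ≤ ℤ.∣ S ∣ ℕ.+ E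
  P≤∣S∣+E = ℕP.≤-trans P≤∣M∣
    (subst (λ x → ℤ.∣ x ∣ ≤ ℤ.∣ S ∣ ℕ.+ E) (x-[x-y]≡y S M) (ℤP.∣i-j∣≤∣i∣+∣j∣ S (S - M)))
  3P+P≤4∣S∣+P : 2 ℕ.* P ℕ.+ P ℕ.+ P ≤ 2 ℕ.* (2 ℕ.* ℤ.∣ S ∣) ℕ.+ P
  3P+P≤4∣S∣+P = begin
    2 ℕ.* P ℕ.+ P ℕ.+ P          ≡⟨ 2*x+x+x≡4*x P ⟩
    4 ℕ.* P                      ≤⟨ ℕP.*-monoʳ-≤ 4 P≤∣S∣+E ⟩
    4 ℕ.* (ℤ.∣ S ∣ ℕ.+ E)         ≡⟨ ℕP.*-distribˡ-+ 4 ℤ.∣ S ∣ E ⟩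
    4 ℕ.* ℤ.∣ S ∣ ℕ.+ 4 ℕ.* E     ≤⟨ ℕP.+-monoʳ-≤ (4 ℕ.* ℤ.∣ S ∣) 4E≤P ⟩
    4 ℕ.* ℤ.∣ S ∣ ℕ.+ P           ≡⟨ 4*x+y≡2*[2*x]+y ℤ.∣ S ∣ P ⟩
    2 ℕ.* (2 ℕ.* ℤ.∣ S ∣) ℕ.+ P   ∎

termConstant : ℕ → ℕ
termConstant N = 2 ^ N ℕ.* suc N ^ suc N

errorConstant : ℕ → ℕ
errorConstant N = 2 ℕ.* (suc N ^ 3 ℕ.* termConstant N)

errorConstant≢0 : ∀ N → ℕ.NonZero (errorConstant N)
errorConstant≢0 N = ℕP.m*n≢0 2 _ {{_}}
  {{ℕP.m*n≢0 (suc N ^ 3) (termConstant N) {{ℕP.m^n≢0 (suc N) 3}}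
    {{ℕP.m*n≢0 (2 ^ N) (suc N ^ suc N) {{ℕP.m^n≢0 2 N}} {{ℕP.m^n≢0 (suc N) (suc N)}}}}}}

module Estimate
  {N q k d : ℕ} {a : Coeffs d} {t : ℕ} {c : Vector ℤ t}
  (‖a‖≡N : norm d a ≡ N) (lead≢0 : lead d a ≢ 0ℤ) (1≤k : 1 ≤ k) (t<d : t < d)
  (∣c∣*q≤k : ∀ i → ℤ.∣ c i ∣ ℕ.* q ≤ k)
  (j : Fin t) (moment≢0 : moment c (suc (toℕ j)) ≢ 0ℤ)
  (lower-moments≡0 : ∀ r → r < toℕ j → moment c (suc r) ≡ 0ℤ)
  where

  open Expansion k c

  instance
    k≢0 : ℕ.NonZero k
    k≢0 = ℕ.>-nonZero 1≤k

  L P W : ℕ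
  L = suc N
  P = k ^ (d ∸ suc (toℕ j))
  W = termConstant N ℕ.* P

  d≤N : d ≤ N
  d≤N = subst (d ≤_) ‖a‖≡N (ℕP.m≤m+n d _)

  ∣a∣≤L : ∀ n → ℤ.∣ a n ∣ ≤ L
  ∣a∣≤L n = ℕP.m≤n⇒m≤1+n
    (subst (ℤ.∣ a n ∣ ≤_) ‖a‖≡N (ℕP.≤-trans (f≤Σℕ (suc d) (λ i → ℤ.∣ a i ∣) n) (ℕP.m≤n+m _ d)))

  q*∣moment∣≤t*[k*t^r] : ∀ r → q ℕ.* ℤ.∣ moment c r ∣ ≤ t ℕ.* (k ℕ.* t ^ r)
  q*∣moment∣≤t*[k*t^r] r = q*∣∑∣≤n*W q (k ℕ.* t ^ r) _ λ i → begin
    q ℕ.* ℤ.∣ c i * (+ suc (toℕ i)) ℤ.^ r ∣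
      ≡⟨ cong (q ℕ.*_) (trans (ℤP.abs-* (c i) _) (cong (ℤ.∣ c i ∣ ℕ.*_) (∣i^n∣≡∣i∣^n (+ suc (toℕ i)) r))) ⟩
    q ℕ.* (ℤ.∣ c i ∣ ℕ.* suc (toℕ i) ^ r)
      ≡⟨ x*[y*z]≡y*x*z q ℤ.∣ c i ∣ _ ⟩
    ℤ.∣ c i ∣ ℕ.* q ℕ.* suc (toℕ i) ^ r
      ≤⟨ ℕP.*-mono-≤ (∣c∣*q≤k i) (ℕP.^-monoˡ-≤ r (FinP.toℕ<n i)) ⟩
    k ℕ.* t ^ r ∎
    where
    open ℕP.≤-Reasoning
    x*[y*z]≡y*x*z : ∀ x y z → x ℕ.* (y ℕ.* z) ≡ y ℕ.* x ℕ.* z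
    x*[y*z]≡y*x*z = ℕ-Ring.solve-∀

  ∣term∣≡ : ∀ n r → ℤ.∣ term n r ∣ ≡ (n C suc r) ℕ.* k ^ (n ∸ suc r) ℕ.* ℤ.∣ moment c (suc r) ∣
  ∣term∣≡ n r = begin
    ℤ.∣ term n r ∣
      ≡⟨ ℤP.abs-* (weight n r) (moment c (suc r)) ⟩
    ℤ.∣ weight n r ∣ ℕ.* ℤ.∣ moment c (suc r) ∣
      ≡⟨ cong (ℕ._* ℤ.∣ moment c (suc r) ∣)
           (trans (ℤP.abs-* (+ (n C suc r)) _) (cong ((n C suc r) ℕ.*_) (∣i^n∣≡∣i∣^n (+ k) (n ∸ suc r)))) ⟩
    (n C suc r) ℕ.* k ^ (n ∸ suc r) ℕ.* ℤ.∣ moment c (suc r) ∣ ∎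
    where open ≡-Reasoning

  q*∣term∣≤W : ∀ {n r} → r < n → n ≤ d → n < d ⊎ r ≢ toℕ j → q ℕ.* ℤ.∣ term n r ∣ ≤ W
  q*∣term∣≤W {n} {r} r<n n≤d off-main with toℕ j ℕ.≤? r
  ... | no j≰r =
    subst (λ x → q ℕ.* ℤ.∣ x ∣ ≤ W) (sym term≡0) (ℕP.≤-trans (ℕP.≤-reflexive (ℕP.*-zeroʳ q)) z≤n)
    where
    term≡0 : term n r ≡ 0ℤ
    term≡0 = trans (cong (weight n r *_) (lower-moments≡0 r (ℕP.≰⇒> j≰r))) (ℤP.*-zeroʳ (weight n r))
  ... | yes j≤r = begin
    q ℕ.* ℤ.∣ term n r ∣
      ≡⟨ cong (q ℕ.*_) (∣term∣≡ n r) ⟩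
    q ℕ.* ((n C suc r) ℕ.* k ^ e ℕ.* ℤ.∣ moment c (suc r) ∣)
      ≡⟨ x*[y*z*w]≡y*[z*[x*w]] q (n C suc r) (k ^ e) _ ⟩
    (n C suc r) ℕ.* (k ^ e ℕ.* (q ℕ.* ℤ.∣ moment c (suc r) ∣))
      ≤⟨ ℕP.*-mono-≤ (ℕP.≤-trans (nCk≤2^n n (suc r)) (ℕP.^-monoʳ-≤ 2 n≤N))
                     (ℕP.*-monoʳ-≤ (k ^ e) (q*∣moment∣≤t*[k*t^r] (suc r))) ⟩
    2 ^ N ℕ.* (k ^ e ℕ.* (t ℕ.* (k ℕ.* t ^ suc r)))
      ≡⟨ x*[y*[z*[w*u]]]≡x*[z*u]*[w*y] (2 ^ N) (k ^ e) t k (t ^ suc r) ⟩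
    2 ^ N ℕ.* t ^ suc (suc r) ℕ.* k ^ suc e
      ≤⟨ ℕP.*-mono-≤ (ℕP.*-monoʳ-≤ (2 ^ N) t^[2+r]≤L^[1+N])
                     (ℕP.^-monoʳ-≤ k (n∸[1+r]<d∸[1+j] j≤r r<n n≤d n<d⊎j<r)) ⟩
    W ∎
    where
    open ℕP.≤-Reasoning
    e = n ∸ suc r
    n≤N : n ≤ N
    n≤N = ℕP.≤-trans n≤d d≤N
    t^[2+r]≤L^[1+N] : t ^ suc (suc r) ≤ L ^ suc N
    t^[2+r]≤L^[1+N] = ℕP.≤-trans
      (ℕP.^-monoˡ-≤ (suc (suc r)) (ℕP.≤-trans (ℕP.<⇒≤ t<d) (ℕP.m≤n⇒m≤1+n d≤N)))
      (ℕP.^-monoʳ-≤ L (s≤s (ℕP.≤-trans r<n n≤N)))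
    n<d⊎j<r : n < d ⊎ toℕ j < r
    n<d⊎j<r = Sum.map₂ (λ r≢j → ℕP.≤∧≢⇒< j≤r (r≢j ∘ sym)) off-main
    x*[y*z*w]≡y*[z*[x*w]] : ∀ x y z w → x ℕ.* (y ℕ.* z ℕ.* w) ≡ y ℕ.* (z ℕ.* (x ℕ.* w))
    x*[y*z*w]≡y*[z*[x*w]] = ℕ-Ring.solve-∀
    x*[y*[z*[w*u]]]≡x*[z*u]*[w*y] : ∀ x y z w u →
      x ℕ.* (y ℕ.* (z ℕ.* (w ℕ.* u))) ≡ x ℕ.* (z ℕ.* u) ℕ.* (w ℕ.* y)
    x*[y*[z*[w*u]]]≡x*[z*u]*[w*y] = ℕ-Ring.solve-∀

  q*∣termSum∣≤L*W : ∀ {n} → n < d → q ℕ.* ℤ.∣ termSum n ∣ ≤ L ℕ.* W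
  q*∣termSum∣≤L*W {n} n<d = ℕP.≤-trans
    (q*∣∑∣≤n*W q W (λ r → term n (toℕ r)) (λ r → q*∣term∣≤W (FinP.toℕ<n r) (ℕP.<⇒≤ n<d) (inj₁ n<d)))
    (ℕP.*-monoˡ-≤ W (ℕP.≤-trans (ℕP.<⇒≤ n<d) (ℕP.m≤n⇒m≤1+n d≤N)))

  q*∣termSum-main∣≤L*W : q ℕ.* ℤ.∣ termSum d - term d (toℕ j) ∣ ≤ L ℕ.* W
  q*∣termSum-main∣≤L*W = ℕP.≤-trans
    (subst (λ x → q ℕ.* ℤ.∣ termSum d - term d x ∣ ≤ d ℕ.* W) (FinP.toℕ-inject≤ j t≤d)
      (q*∣∑-fᵢ∣≤n*W q W (λ r → term d (toℕ r)) j′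
        (λ r r≢j′ → q*∣term∣≤W (FinP.toℕ<n r) ℕP.≤-refl (inj₂ (r≢j′ ∘ toℕ≡j⇒≡j′)))))
    (ℕP.*-monoˡ-≤ W (ℕP.m≤n⇒m≤1+n d≤N))
    where
    t≤d = ℕP.<⇒≤ t<d
    j′ : Fin d
    j′ = Fin.inject≤ j t≤d
    toℕ≡j⇒≡j′ : ∀ {r} → toℕ r ≡ toℕ j → r ≡ j′
    toℕ≡j⇒≡j′ eq = FinP.toℕ-injective (trans eq (sym (FinP.toℕ-inject≤ j t≤d)))

  S main : ℤ
  S = Σℤ t (λ i → c i * m d a (suc (toℕ i)) k)
  main = lead d a * term d (toℕ j)

  F : Fin (suc d) → ℤ
  F n = a n * termSum (toℕ n)

  top : Fin (suc d)
  top = Fin.fromℕ d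

  q*∣∑F-F[top]∣≤L*L*L*W : q ℕ.* ℤ.∣ sum F - F top ∣ ≤ L ℕ.* (L ℕ.* (L ℕ.* W))
  q*∣∑F-F[top]∣≤L*L*L*W = ℕP.≤-trans
    (q*∣∑-fᵢ∣≤n*W q (L ℕ.* (L ℕ.* W)) F top λ n n≢top → begin
      q ℕ.* ℤ.∣ F n ∣
        ≡⟨ q*∣i*j∣≡∣i∣*[q*∣j∣] q (a n) _ ⟩
      ℤ.∣ a n ∣ ℕ.* (q ℕ.* ℤ.∣ termSum (toℕ n) ∣)
        ≤⟨ ℕP.*-mono-≤ (∣a∣≤L n) (q*∣termSum∣≤L*W (below-top n≢top)) ⟩
      L ℕ.* (L ℕ.* W) ∎)
    (ℕP.*-monoˡ-≤ (L ℕ.* (L ℕ.* W)) (s≤s d≤N))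
    where
    open ℕP.≤-Reasoning
    below-top : ∀ {n} → n ≢ top → toℕ n < d
    below-top n≢top = ℕP.≤∧≢⇒< (ℕ.s≤s⁻¹ (FinP.toℕ<n _))
      (λ eq → n≢top (FinP.toℕ-injective (trans eq (sym (FinP.toℕ-fromℕ d)))))

  q*∣F[top]-main∣≤L*L*L*W : q ℕ.* ℤ.∣ F top - main ∣ ≤ L ℕ.* (L ℕ.* (L ℕ.* W))
  q*∣F[top]-main∣≤L*L*L*W = begin
    q ℕ.* ℤ.∣ F top - main ∣
      ≡⟨ cong (λ x → q ℕ.* ℤ.∣ x ∣) (trans (cong (λ n → lead d a * termSum n - main) (FinP.toℕ-fromℕ d))
                                             (x*y-x*z≡x*[y-z] (lead d a) _ _)) ⟩
    q ℕ.* ℤ.∣ lead d a * (termSum d - term d (toℕ j)) ∣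
      ≡⟨ q*∣i*j∣≡∣i∣*[q*∣j∣] q (lead d a) _ ⟩
    ℤ.∣ lead d a ∣ ℕ.* (q ℕ.* ℤ.∣ termSum d - term d (toℕ j) ∣)
      ≤⟨ ℕP.*-mono-≤ (∣a∣≤L top) q*∣termSum-main∣≤L*W ⟩
    L ℕ.* (L ℕ.* W)
      ≤⟨ ℕP.m≤n*m (L ℕ.* (L ℕ.* W)) L ⟩
    L ℕ.* (L ℕ.* (L ℕ.* W)) ∎
    where open ℕP.≤-Reasoning

  q*∣S-main∣≤K*P : q ℕ.* ℤ.∣ S - main ∣ ≤ errorConstant N ℕ.* P
  q*∣S-main∣≤K*P = begin
    q ℕ.* ℤ.∣ S - main ∣
      ≡⟨ cong (λ x → q ℕ.* ℤ.∣ x - main ∣) (∑c*m≡∑a*termSum d a) ⟩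
    q ℕ.* ℤ.∣ sum F - main ∣
      ≡⟨ cong (λ x → q ℕ.* ℤ.∣ x ∣) (x-y≡[x-z]+[z-y] (sum F) main (F top)) ⟩
    q ℕ.* ℤ.∣ (sum F - F top) + (F top - main) ∣
      ≤⟨ ℕP.*-monoʳ-≤ q (ℤP.∣i+j∣≤∣i∣+∣j∣ (sum F - F top) _) ⟩
    q ℕ.* (ℤ.∣ sum F - F top ∣ ℕ.+ ℤ.∣ F top - main ∣)
      ≡⟨ ℕP.*-distribˡ-+ q _ _ ⟩
    q ℕ.* ℤ.∣ sum F - F top ∣ ℕ.+ q ℕ.* ℤ.∣ F top - main ∣
      ≤⟨ ℕP.+-mono-≤ q*∣∑F-F[top]∣≤L*L*L*W q*∣F[top]-main∣≤L*L*L*W ⟩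
    L ℕ.* (L ℕ.* (L ℕ.* W)) ℕ.+ L ℕ.* (L ℕ.* (L ℕ.* W))
      ≡⟨ x³[yz]+x³[yz]≡2[x³y]z L (termConstant N) P ⟩
    errorConstant N ℕ.* P ∎
    where
    open ℕP.≤-Reasoning
    x-y≡[x-z]+[z-y] : ∀ x y z → x - y ≡ (x - z) + (z - y)
    x-y≡[x-z]+[z-y] = solve-∀
    -- x ^ 3 written out, as the ring solver does not parse _^_
    x³[yz]+x³[yz]≡2[x³y]z : ∀ x y z →
      x ℕ.* (x ℕ.* (x ℕ.* (y ℕ.* z))) ℕ.+ x ℕ.* (x ℕ.* (x ℕ.* (y ℕ.* z)))
        ≡ 2 ℕ.* (x ℕ.* (x ℕ.* (x ℕ.* 1)) ℕ.* y) ℕ.* z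
    x³[yz]+x³[yz]≡2[x³y]z = ℕ-Ring.solve-∀

  P≤∣main∣ : P ≤ ℤ.∣ main ∣
  P≤∣main∣ = begin
    P
      ≤⟨ ℕP.m≤n*m P (d C suc (toℕ j)) {{C≢0}} ⟩
    (d C suc (toℕ j)) ℕ.* P
      ≤⟨ ℕP.m≤m*n _ ℤ.∣ moment c (suc (toℕ j)) ∣ {{∣i∣≢0 moment≢0}} ⟩
    (d C suc (toℕ j)) ℕ.* P ℕ.* ℤ.∣ moment c (suc (toℕ j)) ∣
      ≤⟨ ℕP.m≤n*m _ ℤ.∣ lead d a ∣ {{∣i∣≢0 lead≢0}} ⟩
    ℤ.∣ lead d a ∣ ℕ.* ((d C suc (toℕ j)) ℕ.* P ℕ.* ℤ.∣ moment c (suc (toℕ j)) ∣)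
      ≡⟨ trans (ℤP.abs-* (lead d a) _) (cong (ℤ.∣ lead d a ∣ ℕ.*_) (∣term∣≡ d (toℕ j))) ⟨
    ℤ.∣ main ∣ ∎
    where
    open ℕP.≤-Reasoning
    C≢0 : ℕ.NonZero (d C suc (toℕ j))
    C≢0 = ℕ.>-nonZero (k≤n⇒nCk>0 (ℕP.≤-trans (FinP.toℕ<n j) (ℕP.<⇒≤ t<d)))

m≤n∸1⇒m<n : ∀ {m n} → 1 ≤ m → m ≤ n ∸ 1 → m < n
m≤n∸1⇒m<n {n = zero}  (s≤s z≤n) ()
m≤n∸1⇒m<n {n = suc n} _         m≤n = s≤s m≤n

proposition2p5 : (N : ℕ) → ∃ λ (q₀ : ℕ) → (q : ℕ) → q₀ ≤ q →
    ∃ λ (k₀ : ℕ) → (k : ℕ) → k₀ ≤ k →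
    (d : ℕ) → (a : Coeffs d) → norm d a ≡ N →
    2 ≤ d → ℤ.0ℤ ℤ.< lead d a → NonOdd d a →
    (t : ℕ) → 1 ≤ t → t ≤ d ∸ 1 →
    (c : Fin t → ℤ) → (∃ λ (i : Fin t) → c i ≢ ℤ.0ℤ) →
    ((i : Fin t) → ℤ.∣ c i ∣ ℕ.* q ≤ k) →
    k ^ (d ∸ t) < 2 ℕ.* ℤ.∣ Σℤ t (λ i → c i ℤ.* m d a (suc (toℕ i)) k) ∣
proposition2p5 N =
  4 ℕ.* errorConstant N , λ q 4K≤q →
  1 , λ k 1≤k d a ‖a‖≡N _ 0<lead _ t 1≤t t≤d∸1 c (i , cᵢ≢0) ∣c∣*q≤k →
  let j , moment≢0 , lower-moments≡0 = lowest-nonvanishing-moment c i cᵢ≢0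
      open Estimate {q = q} {a = a} {c = c} ‖a‖≡N (ℤP.<⇒≢ 0<lead ∘ sym) 1≤k (m≤n∸1⇒m<n 1≤t t≤d∸1)
                    ∣c∣*q≤k j moment≢0 lower-moments≡0
  in ℕP.≤-<-trans (ℕP.^-monoʳ-≤ k (ℕP.∸-monoʳ-≤ d (FinP.toℕ<n j)))
       (main-term-dominates S main {{errorConstant≢0 N}} (ℕP.m^n>0 k (d ∸ suc (toℕ j))) 4K≤q
          P≤∣main∣ q*∣S-main∣≤K*P)
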